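{- Let $n>2$ and let $\mathbb{BP}_n$ be the burnt pancake graph. Then \[ \gamma(\mathbb{BP}_n)\geq 2^{n-4}(3n-8)\,n!+1 . \]
   Context: For a graph $G$, $\gamma(G)$ denotes its genus: the minimum genus of a closed orientable surface on which $G$ can be embedded without edge crossings. The burnt pancake graph $\mathbb{BP}_n$ is the simple undirected graph whose vertex set is the set of signed permutations of $[n]$. These are words $\pi_1^{a_1}\cdots\pi_n^{a_n}$, where $\pi_1\cdots\pi_n$ is a permutation of $[n]$ and each sign $a_j\in\{+,-\}$; there are $2^n n!$ of them. For $1\le i\le n$ the prefix reversal $r_i$ reverses the order of the first $i$ entries and flips the sign of each of those $i$ entries, leaving the rest unchanged. Two vertices $\pi,\sigma$ are adjacent iff $\sigma=r_i(\pi)$ for some $1\le i\le n$. Hence $\mathbb{BP}_n$ has $2^n n!$ vertices and $2^{n-1}n!\,n$ edges. -}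

module Defs where

open import Data.Nat using (ℕ; zero; suc; _+_; _*_; _∸_; _^_; _!)
open import Data.Fin using (Fin; toℕ)
open import Data.Bool using (Bool; not)
open import Data.Product using (_×_; _,_; proj₁; ∃)
open import Data.List using (List; length; map; reverse; take; drop; _++_)
open import Data.List.Relation.Unary.Unique.Propositional using (Unique)
open import Data.List.Relation.Unary.All using (All)
open import Data.List.Relation.Unary.AllPairs using (AllPairs)
open import Data.List.Membership.Propositional using (_∈_)
open import Relation.Binary.PropositionalEquality using (_≡_)
open import Relation.Nullary using (¬_)
open import Function.Definitions using (Injective)

-- Signed permutations of [n] (entries relabelled as Fin n = {0..n-1}),
-- sign + ↦ true, - ↦ false.

Word : ℕ → Set
Word n = List (Fin n × Bool)

IsSignedPerm : (n : ℕ) → Word n → Set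
IsSignedPerm n w = (length w ≡ n) × Unique (map proj₁ w)

flipSign : ∀ {n} → Fin n × Bool → Fin n × Bool
flipSign (a , s) = a , not s

prefixRev : ∀ {n} → ℕ → Word n → Word n
prefixRev k w = map flipSign (reverse (take k w)) ++ drop k w

-- r i  is the prefix reversal  r_{i+1}  (so i : Fin n ranges over r_1 … r_n)
r : ∀ {n} → Fin n → Word n → Word n
r i = prefixRev (suc (toℕ i))

-- Burnt pancake graph BP_n: vertices = signed permutations,
-- π adjacent to r_i π.  Its darts (edge-ends) are pairs (π , i): the end at
-- π of the edge {π , r_i π}; distinct i give distinct neighbours, so this is
-- the simple graph.  The reversed dart of (π , i) is (r_i π , i).

Dart : ℕ → Set
Dart n = Word n × Fin n

IsDart : (n : ℕ) → Dart n → Set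
IsDart n (π , i) = IsSignedPerm n π

numVertices : ℕ → ℕ
numVertices n = 2 ^ n * n !

numEdges : ℕ → ℕ
numEdges n = 2 ^ (n ∸ 1) * n ! * n

-- Embeddings in closed orientable surfaces, combinatorially: rotation
-- systems (Heffter–Edmonds–Ringel).

iter : ∀ {A : Set} → ℕ → (A → A) → A → A
iter zero    f x = x
iter (suc k) f x = f (iter k f x)

IsCyclicPerm : (n : ℕ) → (Fin n → Fin n) → Set
IsCyclicPerm n f = Injective _≡_ _≡_ f × (∀ i j → ∃ λ k → iter k f i ≡ j)

RotationSystem : ℕ → Set
RotationSystem n = Word n → Fin n → Fin n

IsRotationSystem : (n : ℕ) → RotationSystem n → Set
IsRotationSystem n ρ = ∀ π → IsSignedPerm n π → IsCyclicPerm n (ρ π)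

facePerm : ∀ {n} → RotationSystem n → Dart n → Dart n
facePerm ρ (π , i) = r i π , ρ (r i π) i

SameFace : ∀ {n} → RotationSystem n → Dart n → Dart n → Set
SameFace ρ d e = ∃ λ k → iter k (facePerm ρ) d ≡ e

-- F is the number of faces of the embedding ρ: the number of orbits of
-- facePerm ρ, witnessed by a list of darts containing exactly one dart
-- from each orbit.
HasFaceCount : (n : ℕ) → RotationSystem n → ℕ → Set
HasFaceCount n ρ F =
  ∃ λ (reps : List (Dart n)) →
    (length reps ≡ F)
    × All (IsDart n) reps
    × AllPairs (λ d e → ¬ SameFace ρ d e) reps
    × (∀ d → IsDart n d → ∃ λ e → (e ∈ reps) × SameFace ρ e d)

-- g is the genus of the embedding given by ρ (Euler: V - E + F = 2 - 2g)
EmbeddingGenus : (n : ℕ) → RotationSystem n → ℕ → Set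
EmbeddingGenus n ρ g =
  ∃ λ F → HasFaceCount n ρ F × (numVertices n + F + 2 * g ≡ 2 + numEdges n)

-- γ(BP_n) ≥ b/2 : every embedding of BP_n has genus g with b ≤ 2g
TwiceGenusAtLeast : ℕ → ℕ → Set
TwiceGenusAtLeast n b =
  ∀ ρ → IsRotationSystem n ρ → ∀ g → EmbeddingGenus n ρ g → b Data.Nat.≤ 2 * g

-- Euler's formula V + F + 2g = 2 + E turns a lower bound on face lengths into a lower bound on
-- the genus: if every face of an embedding of BP_n has length at least 8, then 8F ≤ 2E and
-- 2g ≥ 2 + 3E/4 − V = 2 + 2^(n−3)(3n−8)n!.
-- A face boundary is a closed walk π, r_{i₁}π, r_{i₂}r_{i₁}π, … with consecutive indices distinct
-- (a rotation has no fixed points), and no such walk has length 1 to 7. Indeed, let r_{m+1} be the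
-- longest reversal used and start the walk at a suitable occurrence of it. The pancake at position
-- m+1 goes to the top, and after at most five steps it lies among the top m pancakes or at position
-- m+1 upside down; the shorter reversals that follow cannot undo this, so the walk is not closed.

module Submission where

open import Defs
open import Data.Nat using (ℕ; _+_; _*_; _∸_; _^_; _!; _<_)
open import Data.Nat
open import Data.Nat.Properties
open import Data.Nat.DivMod using (_%_; _/_; m≡m%n+[m/n]*n; m%n<n)
open import Data.Nat.Solver using (module +-*-Solver)
open import Data.Bool using (Bool; true; false; not)
open import Data.Bool.Properties using (not-involutive)
open import Data.Fin using (Fin; toℕ; zero; suc)
open import Data.Fin.Properties using (toℕ<n; toℕ-injective; injective⇒≤; pigeonhole)
import Data.Fin.Properties as Fin
open import Data.Maybe using (Maybe; just; nothing)
import Data.Maybe as Maybe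
open import Data.Maybe.Properties using (just-injective)
open import Data.Product using (_×_; _,_; proj₁; proj₂; ∃)
open import Data.Sum using (_⊎_; inj₁; inj₂)
open import Data.Empty using (⊥; ⊥-elim)
open import Data.List using (List; []; _∷_; _++_; [_]; map; reverse; take; drop; length; concatMap; filter; lookup; allFin; applyUpTo; upTo)
open import Data.List.Properties
open import Data.List.Extrema.Nat using (argmax; f[xs]≤f[argmax])
open import Data.List.Relation.Unary.All as All using (All; []; _∷_)
import Data.List.Relation.Unary.All.Properties as All
open import Data.List.Relation.Unary.Any as Any using (here; there; index)
open import Data.List.Relation.Unary.AllPairs using (AllPairs; []; _∷_)
open import Data.List.Relation.Unary.AllPairs.Properties using (applyUpTo⁺₁)
open import Data.List.Relation.Unary.Unique.Propositional using (Unique)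
import Data.List.Relation.Unary.Unique.Propositional.Properties as Unique
open import Data.List.Relation.Binary.Disjoint.Propositional using (Disjoint)
open import Data.List.Relation.Binary.Subset.Propositional using (_⊆_)
open import Data.List.Relation.Binary.Permutation.Propositional using (↭-sym; ↭⇒↭ₛ)
open import Data.List.Relation.Binary.Permutation.Propositional.Properties using (↭-reverse; ++⁺ʳ)
import Data.List.Relation.Binary.Permutation.Setoid.Properties as PermutationSetoid
open import Data.List.Membership.Propositional using (_∈_)
open import Data.List.Membership.Propositional.Properties
  using (∈-map⁺; ∈-lookup; ∈-concatMap⁺; ∈-filter⁺; ∈-allFin; ∈-upTo⁺; ∈-applyUpTo⁻)
open import Data.List.Membership.Setoid.Properties using (index-injective)
open import Function using (_∘_)
open import Relation.Nullary using (¬_; yes; no; ¬?)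
open import Relation.Binary.PropositionalEquality hiding ([_])

-- A pancake is tracked as (q , s): its 0-based position q and whether it keeps its original
-- orientation. flipAt i is the effect of the reversal r_{i+1} of length i + 1 (written r i in Defs).
opaque
  flipAt : ℕ → ℕ × Bool → ℕ × Bool
  flipAt i (q , s) with q ≤? i
  ... | yes _ = i ∸ q , not s
  ... | no  _ = q , s

  flipAt-≤ : ∀ {i q} s → q ≤ i → flipAt i (q , s) ≡ (i ∸ q , not s)
  flipAt-≤ {i} {q} s q≤i with q ≤? i
  ... | yes _   = refl
  ... | no  q≰i = ⊥-elim (q≰i q≤i)

  flipAt-> : ∀ {i q} s → i < q → flipAt i (q , s) ≡ (q , s)
  flipAt-> {i} {q} s i<q with q ≤? i
  ... | yes q≤i = ⊥-elim (<⇒≱ i<q q≤i)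
  ... | no  _   = refl

flips : List ℕ → ℕ × Bool → ℕ × Bool
flips []       p = p
flips (i ∷ is) p = flips is (flipAt i p)

Sunk : ℕ → ℕ × Bool → Set
Sunk m (q , s) = q < m ⊎ (q ≡ m × s ≡ false)

flipAt-Sunk : ∀ {m i} p → i < m → Sunk m p → Sunk m (flipAt i p)
flipAt-Sunk {m} {i} (q , s) i<m sunk with ≤-<-connex q i
... | inj₁ q≤i rewrite flipAt-≤ s q≤i = inj₁ (≤-<-trans (m∸n≤m i q) i<m)
... | inj₂ i<q rewrite flipAt-> s i<q = sunk

flips-Sunk-≢ : ∀ {m} is p → All (_< m) is → Sunk m p → flips is p ≢ (m , true)
flips-Sunk-≢ []       (q , s) []           (inj₁ q<m)       refl = <-irrefl refl q<m
flips-Sunk-≢ []       (q , s) []           (inj₂ (_ , ())) refl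
flips-Sunk-≢ (i ∷ is) p       (i<m ∷ is<m) sunk             = flips-Sunk-≢ is (flipAt i p) is<m (flipAt-Sunk p i<m sunk)

Sunk-downward : ∀ {m q} → q ≤ m → Sunk m (q , false)
Sunk-downward q≤m with m≤n⇒m<n∨m≡n q≤m
... | inj₁ q<m = inj₁ q<m
... | inj₂ q≡m = inj₂ (q≡m , refl)

Sunk-∸ : ∀ {m y} s → 0 < y → y ≤ m → Sunk m (m ∸ y , s)
Sunk-∸ {m} {y} s 0<y y≤m = inj₁ (∸-monoʳ-< 0<y y≤m)

flipAt-top : ∀ m → flipAt m (m , true) ≡ (0 , false)
flipAt-top m rewrite flipAt-≤ true (≤-refl {m}) | n∸n≡0 m = refl

flipAt-bottom : ∀ {i} s → flipAt i (0 , s) ≡ (i , not s)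
flipAt-bottom s = flipAt-≤ s z≤n

sunk-m : ∀ m → Sunk m (flips (m ∷ []) (m , true))
sunk-m m rewrite flipAt-top m = Sunk-downward z≤n

flips-mam : ∀ {m a} → a < m → flips (m ∷ a ∷ m ∷ []) (m , true) ≡ (m ∸ a , false)
flips-mam {m} {a} a<m rewrite flipAt-top m | flipAt-bottom {a} false = flipAt-≤ true (<⇒≤ a<m)

sunk-mam : ∀ {m a} → a < m → Sunk m (flips (m ∷ a ∷ m ∷ []) (m , true))
sunk-mam {m} {a} a<m rewrite flips-mam a<m = Sunk-downward (m∸n≤m m a)

sunk-mabm : ∀ {m a b} → a < m → b < m → a ≢ b → Sunk m (flips (m ∷ a ∷ b ∷ m ∷ []) (m , true))
sunk-mabm {m} {a} {b} a<m b<m a≢b rewrite flipAt-top m | flipAt-bottom {a} false with ≤-<-connex a b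
... | inj₁ a≤b rewrite flipAt-≤ true a≤b | flipAt-≤ false (≤-trans (m∸n≤m b a) (<⇒≤ b<m)) =
  Sunk-∸ true (m<n⇒0<n∸m (≤∧≢⇒< a≤b a≢b)) (≤-trans (m∸n≤m b a) (<⇒≤ b<m))
... | inj₂ b<a rewrite flipAt-> true b<a | flipAt-≤ true (<⇒≤ a<m) =
  Sunk-∸ false (≤-<-trans z≤n b<a) (<⇒≤ a<m)

sunk-mambm : ∀ {m a b} → a < m → b < m → Sunk m (flips (m ∷ a ∷ m ∷ b ∷ m ∷ []) (m , true))
sunk-mambm {m} {a} {b} a<m b<m rewrite flips-mam a<m with ≤-<-connex (m ∸ a) b
... | inj₁ m∸a≤b rewrite flipAt-≤ false m∸a≤b | flipAt-≤ true (≤-trans (m∸n≤m b (m ∸ a)) (<⇒≤ b<m)) =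
  Sunk-downward (m∸n≤m m (b ∸ (m ∸ a)))
... | inj₂ b<m∸a rewrite flipAt-> false b<m∸a | flipAt-≤ false (m∸n≤m m a) | m∸[m∸n]≡n (<⇒≤ a<m) =
  inj₁ a<m

window : (ℕ → ℕ) → ℕ → ℕ → List ℕ
window ℓ j zero    = []
window ℓ j (suc t) = ℓ j ∷ window ℓ (suc j) t

module _ (ℓ : ℕ → ℕ) {m : ℕ} where

  window-m-sinks : ∀ j t → ℓ j ≡ m → All (_< m) (window ℓ (1 + j) t) →
                   flips (window ℓ j (1 + t)) (m , true) ≢ (m , true)
  window-m-sinks j t e rest rewrite e = flips-Sunk-≢ (window ℓ (1 + j) t) _ rest (sunk-m m)

  window-mam-sinks : ∀ j t → ℓ j ≡ m → ℓ (1 + j) < m → ℓ (2 + j) ≡ m →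
                     All (_< m) (window ℓ (3 + j) t) →
                     flips (window ℓ j (3 + t)) (m , true) ≢ (m , true)
  window-mam-sinks j t e₀ a e₂ rest rewrite e₀ | e₂ =
    flips-Sunk-≢ (window ℓ (3 + j) t) _ rest (sunk-mam a)

  window-mabm-sinks : ∀ j t → ℓ j ≡ m → ℓ (1 + j) < m → ℓ (2 + j) < m → ℓ (1 + j) ≢ ℓ (2 + j) →
                      ℓ (3 + j) ≡ m → All (_< m) (window ℓ (4 + j) t) →
                      flips (window ℓ j (4 + t)) (m , true) ≢ (m , true)
  window-mabm-sinks j t e₀ a b a≢b e₃ rest rewrite e₀ | e₃ =
    flips-Sunk-≢ (window ℓ (4 + j) t) _ rest (sunk-mabm a b a≢b)

  window-mambm-sinks : ∀ j t → ℓ j ≡ m → ℓ (1 + j) < m → ℓ (2 + j) ≡ m → ℓ (3 + j) < m →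
                       ℓ (4 + j) ≡ m → All (_< m) (window ℓ (5 + j) t) →
                       flips (window ℓ j (5 + t)) (m , true) ≢ (m , true)
  window-mambm-sinks j t e₀ a e₂ b e₄ rest rewrite e₀ | e₂ | e₄ =
    flips-Sunk-≢ (window ℓ (5 + j) t) _ rest (sunk-mambm a b)

-- ℓ lists the reversals of a closed walk of period c ≤ 7 (0-based, no two consecutive equal) and
-- m = ℓ s is the largest one. Some window of length c starts with m, m a m, m a b m or m a m b m
-- and continues with labels below m only; which one depends on the pattern of occurrences of m
-- among ℓ (2 + s), …, ℓ (c ∸ 2 + s), and sometimes the window has to start at a later m.
module ShortPeriod (ℓ : ℕ → ℕ) (m s : ℕ) (ℓ≤m : ∀ j → ℓ j ≤ m) (ℓs≡m : ℓ s ≡ m)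
                   (stutter-free : ∀ j → ℓ (suc j) ≢ ℓ j) where

  Sinks : ℕ → ℕ → Set
  Sinks c j = flips (window ℓ j c) (m , true) ≢ (m , true)

  Periodic : ℕ → Set
  Periodic c = ∀ j → ℓ (c + j) ≡ ℓ j

  no-adjacent-tops : ∀ {j} → ℓ j ≡ m → ℓ (suc j) ≢ m
  no-adjacent-tops ℓj≡m ℓj+1≡m = stutter-free _ (trans ℓj+1≡m (sym ℓj≡m))

  below-after-top : ∀ {j} → ℓ j ≡ m → ℓ (suc j) < m
  below-after-top ℓj≡m = ≤∧≢⇒< (ℓ≤m _) (no-adjacent-tops ℓj≡m)

  below-before-top : ∀ {j} → ℓ (suc j) ≡ m → ℓ j < m
  below-before-top ℓj+1≡m = ≤∧≢⇒< (ℓ≤m _) (λ ℓj≡m → no-adjacent-tops ℓj≡m ℓj+1≡m)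

  data Level (j : ℕ) : Set where
    top   : ℓ j ≡ m → Level j
    below : ℓ j < m → Level j

  level : ∀ j → Level j
  level j with ℓ j ≟ m
  ... | yes ℓj≡m = top ℓj≡m
  ... | no  ℓj≢m = below (≤∧≢⇒< (ℓ≤m j) ℓj≢m)

  ℓ[1+s]<m : ℓ (1 + s) < m
  ℓ[1+s]<m = below-after-top ℓs≡m

  ℓ[1+s]≢ℓ[2+s] : ℓ (1 + s) ≢ ℓ (2 + s)
  ℓ[1+s]≢ℓ[2+s] = ≢-sym (stutter-free (1 + s))

  module Period (c : ℕ) (periodic : Periodic (suc c)) where

    wrap-top : ∀ {j} → ℓ j ≡ m → ℓ (suc c + j) ≡ m
    wrap-top ℓj≡m = trans (periodic _) ℓj≡m

    wrap-below : ∀ {j} → ℓ j < m → ℓ (suc c + j) < m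
    wrap-below ℓj<m = subst (_< m) (sym (periodic _)) ℓj<m

    ℓ[c+s]<m : ℓ (c + s) < m
    ℓ[c+s]<m = below-before-top (wrap-top ℓs≡m)

  module _ (per : Periodic 4) where
    open Period 3 per

    period4 : Level (2 + s) → ∃ (Sinks 4)
    period4 (top   e₂) = s , window-mam-sinks ℓ s 1 ℓs≡m ℓ[1+s]<m e₂ (ℓ[c+s]<m ∷ [])
    period4 (below b₂) = s , window-m-sinks ℓ s 3 ℓs≡m (ℓ[1+s]<m ∷ b₂ ∷ ℓ[c+s]<m ∷ [])

  module _ (per : Periodic 5) where
    open Period 4 per

    period5 : Level (2 + s) → Level (3 + s) → ∃ (Sinks 5)
    period5 (top   e₂) (top   e₃) = ⊥-elim (no-adjacent-tops e₂ e₃)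
    period5 (top   e₂) (below b₃) = s , window-mam-sinks ℓ s 2 ℓs≡m ℓ[1+s]<m e₂ (b₃ ∷ ℓ[c+s]<m ∷ [])
    period5 (below b₂) (top   e₃) = s , window-mabm-sinks ℓ s 1 ℓs≡m ℓ[1+s]<m b₂ ℓ[1+s]≢ℓ[2+s] e₃ (ℓ[c+s]<m ∷ [])
    period5 (below b₂) (below b₃) = s , window-m-sinks ℓ s 4 ℓs≡m (ℓ[1+s]<m ∷ b₂ ∷ b₃ ∷ ℓ[c+s]<m ∷ [])

  module _ (per : Periodic 6) where
    open Period 5 per

    period6 : Level (2 + s) → Level (3 + s) → Level (4 + s) → ∃ (Sinks 6)
    period6 (top   e₂) (top   e₃) _          = ⊥-elim (no-adjacent-tops e₂ e₃)
    period6 _          (top   e₃) (top   e₄) = ⊥-elim (no-adjacent-tops e₃ e₄)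
    period6 (top   e₂) (below b₃) (top   e₄) = s , window-mambm-sinks ℓ s 1 ℓs≡m ℓ[1+s]<m e₂ b₃ e₄ (ℓ[c+s]<m ∷ [])
    period6 (top   e₂) (below b₃) (below b₄) = s , window-mam-sinks ℓ s 3 ℓs≡m ℓ[1+s]<m e₂ (b₃ ∷ b₄ ∷ ℓ[c+s]<m ∷ [])
    period6 (below b₂) (top   e₃) (below b₄) = s , window-mabm-sinks ℓ s 2 ℓs≡m ℓ[1+s]<m b₂ ℓ[1+s]≢ℓ[2+s] e₃ (b₄ ∷ ℓ[c+s]<m ∷ [])
    period6 (below b₂) (below b₃) (top   e₄) =
      4 + s , window-mam-sinks ℓ (4 + s) 3 e₄ ℓ[c+s]<m (wrap-top ℓs≡m) (wrap-below ℓ[1+s]<m ∷ wrap-below b₂ ∷ wrap-below b₃ ∷ [])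
    period6 (below b₂) (below b₃) (below b₄) = s , window-m-sinks ℓ s 5 ℓs≡m (ℓ[1+s]<m ∷ b₂ ∷ b₃ ∷ b₄ ∷ ℓ[c+s]<m ∷ [])

  module _ (per : Periodic 7) where
    open Period 6 per

    period7 : Level (2 + s) → Level (3 + s) → Level (4 + s) → Level (5 + s) → ∃ (Sinks 7)
    period7 (top   e₂) (top   e₃) _          _          = ⊥-elim (no-adjacent-tops e₂ e₃)
    period7 _          (top   e₃) (top   e₄) _          = ⊥-elim (no-adjacent-tops e₃ e₄)
    period7 _          _          (top   e₄) (top   e₅) = ⊥-elim (no-adjacent-tops e₄ e₅)
    period7 (top   e₂) (below b₃) (top   e₄) (below b₅) =
      s , window-mambm-sinks ℓ s 2 ℓs≡m ℓ[1+s]<m e₂ b₃ e₄ (b₅ ∷ ℓ[c+s]<m ∷ [])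
    period7 (top   e₂) (below b₃) (below b₄) (top   e₅) =
      5 + s , window-mambm-sinks ℓ (5 + s) 2 e₅ ℓ[c+s]<m (wrap-top ℓs≡m) (wrap-below ℓ[1+s]<m) (wrap-top e₂)
                (wrap-below b₃ ∷ wrap-below b₄ ∷ [])
    period7 (top   e₂) (below b₃) (below b₄) (below b₅) =
      s , window-mam-sinks ℓ s 4 ℓs≡m ℓ[1+s]<m e₂ (b₃ ∷ b₄ ∷ b₅ ∷ ℓ[c+s]<m ∷ [])
    period7 (below b₂) (top   e₃) (below b₄) (top   e₅) =
      3 + s , window-mambm-sinks ℓ (3 + s) 2 e₃ b₄ e₅ ℓ[c+s]<m (wrap-top ℓs≡m) (wrap-below ℓ[1+s]<m ∷ wrap-below b₂ ∷ [])
    period7 (below b₂) (top   e₃) (below b₄) (below b₅) =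
      s , window-mabm-sinks ℓ s 3 ℓs≡m ℓ[1+s]<m b₂ ℓ[1+s]≢ℓ[2+s] e₃ (b₄ ∷ b₅ ∷ ℓ[c+s]<m ∷ [])
    period7 (below b₂) (below b₃) (top   e₄) (below b₅) =
      4 + s , window-mabm-sinks ℓ (4 + s) 3 e₄ b₅ ℓ[c+s]<m (≢-sym (stutter-free (5 + s))) (wrap-top ℓs≡m)
                (wrap-below ℓ[1+s]<m ∷ wrap-below b₂ ∷ wrap-below b₃ ∷ [])
    period7 (below b₂) (below b₃) (below b₄) (top   e₅) =
      5 + s , window-mam-sinks ℓ (5 + s) 4 e₅ ℓ[c+s]<m (wrap-top ℓs≡m)
                (wrap-below ℓ[1+s]<m ∷ wrap-below b₂ ∷ wrap-below b₃ ∷ wrap-below b₄ ∷ [])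
    period7 (below b₂) (below b₃) (below b₄) (below b₅) =
      s , window-m-sinks ℓ s 6 ℓs≡m (ℓ[1+s]<m ∷ b₂ ∷ b₃ ∷ b₄ ∷ b₅ ∷ ℓ[c+s]<m ∷ [])

  short-period-sinks : ∀ c → 1 ≤ c → c ≤ 7 → Periodic c → ∃ (Sinks c)
  short-period-sinks 0 () _ _
  short-period-sinks 1 _ _ per = ⊥-elim (stutter-free s (per s))
  short-period-sinks 2 _ _ per = s , window-m-sinks ℓ s 1 ℓs≡m (Period.ℓ[c+s]<m 1 per ∷ [])
  short-period-sinks 3 _ _ per = s , window-m-sinks ℓ s 2 ℓs≡m (ℓ[1+s]<m ∷ Period.ℓ[c+s]<m 2 per ∷ [])
  short-period-sinks 4 _ _ per = period4 per (level (2 + s))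
  short-period-sinks 5 _ _ per = period5 per (level (2 + s)) (level (3 + s))
  short-period-sinks 6 _ _ per = period6 per (level (2 + s)) (level (3 + s)) (level (4 + s))
  short-period-sinks 7 _ _ per = period7 per (level (2 + s)) (level (3 + s)) (level (4 + s)) (level (5 + s))
  short-period-sinks (suc (suc (suc (suc (suc (suc (suc (suc c)))))))) _ c+8≤7 _ =
    ⊥-elim (≤⇒≯ c+8≤7 (s≤s (m≤m+n 7 c)))

module _ {A : Set} where
  open ≡-Reasoning

  nth : List A → ℕ → Maybe A
  nth []       _       = nothing
  nth (x ∷ xs) zero    = just x
  nth (x ∷ xs) (suc j) = nth xs j

  nth-++ˡ : ∀ xs {ys} {j} → j < length xs → nth (xs ++ ys) j ≡ nth xs j
  nth-++ˡ (x ∷ xs) {j = zero}  _         = refl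
  nth-++ˡ (x ∷ xs) {j = suc j} (s≤s j<n) = nth-++ˡ xs j<n

  nth-++ʳ : ∀ xs {ys} j → nth (xs ++ ys) (length xs + j) ≡ nth ys j
  nth-++ʳ []       j = refl
  nth-++ʳ (x ∷ xs) j = nth-++ʳ xs j

  nth-take : ∀ k xs {j} → j < k → nth (take k xs) j ≡ nth xs j
  nth-take (suc k) []       _         = refl
  nth-take (suc k) (x ∷ xs) {zero}  _         = refl
  nth-take (suc k) (x ∷ xs) {suc j} (s≤s j<k) = nth-take k xs j<k

  nth-drop : ∀ k xs j → nth (drop k xs) j ≡ nth xs (k + j)
  nth-drop zero    xs       j = refl
  nth-drop (suc k) []       j = refl
  nth-drop (suc k) (x ∷ xs) j = nth-drop k xs j

  nth-reverse : ∀ xs {j} → j < length xs → nth (reverse xs) j ≡ nth xs (length xs ∸ suc j)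
  nth-reverse (x ∷ xs) {j} j<1+n rewrite unfold-reverse x xs with m≤n⇒m<n∨m≡n (≤-pred j<1+n)
  ... | inj₁ j<n = begin
    nth (reverse xs ++ [ x ]) j      ≡⟨ nth-++ˡ (reverse xs) (subst (j <_) (sym (length-reverse xs)) j<n) ⟩
    nth (reverse xs) j               ≡⟨ nth-reverse xs j<n ⟩
    nth xs (length xs ∸ suc j)       ≡⟨ cong (nth (x ∷ xs)) (+-∸-assoc 1 j<n) ⟨
    nth (x ∷ xs) (length xs ∸ j)     ∎
  ... | inj₂ refl = begin
    nth (reverse xs ++ [ x ]) j                      ≡⟨ cong (nth (reverse xs ++ [ x ])) (sym (+-identityʳ j)) ⟩
    nth (reverse xs ++ [ x ]) (length xs + 0)        ≡⟨ cong (λ k → nth (reverse xs ++ [ x ]) (k + 0)) (length-reverse xs) ⟨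
    nth (reverse xs ++ [ x ]) (length (reverse xs) + 0) ≡⟨ nth-++ʳ (reverse xs) 0 ⟩
    just x                                           ≡⟨ cong (nth (x ∷ xs)) (n∸n≡0 (length xs)) ⟨
    nth (x ∷ xs) (length xs ∸ length xs)             ∎

  nth-∈ : ∀ xs {j x} → nth xs j ≡ just x → x ∈ xs
  nth-∈ (x ∷ xs) {zero}  refl = here refl
  nth-∈ (x ∷ xs) {suc j} eq   = there (nth-∈ xs eq)

  nth-defined : ∀ xs {j} → j < length xs → ∃ λ x → nth xs j ≡ just x
  nth-defined (x ∷ xs) {zero}  _         = x , refl
  nth-defined (x ∷ xs) {suc j} (s≤s j<n) = nth-defined xs j<n

module _ {A B : Set} (f : A → B) where

  nth-injective : ∀ xs → Unique (map f xs) → ∀ {i j x y} →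
                  nth xs i ≡ just x → nth xs j ≡ just y → f x ≡ f y → i ≡ j
  nth-injective (x ∷ xs) _            {zero}  {zero}  _   _   _     = refl
  nth-injective (x ∷ xs) (x∉ ∷ _)     {zero}  {suc j} refl eqj fx≡fy = ⊥-elim (All.lookup x∉ (∈-map⁺ f (nth-∈ xs eqj)) fx≡fy)
  nth-injective (x ∷ xs) (x∉ ∷ _)     {suc i} {zero}  eqi refl fx≡fy = ⊥-elim (All.lookup x∉ (∈-map⁺ f (nth-∈ xs eqi)) (sym fx≡fy))
  nth-injective (x ∷ xs) (_ ∷ unique) {suc i} {suc j} eqi eqj fx≡fy  = cong suc (nth-injective xs unique eqi eqj fx≡fy)

  nth-map : ∀ xs j → nth (map f xs) j ≡ Maybe.map f (nth xs j)
  nth-map []       j       = refl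
  nth-map (x ∷ xs) zero    = refl
  nth-map (x ∷ xs) (suc j) = nth-map xs j

module _ {A : Set} where

  take-length-++ : ∀ (xs ys : List A) → take (length xs) (xs ++ ys) ≡ xs
  take-length-++ []       ys = refl
  take-length-++ (x ∷ xs) ys = cong (x ∷_) (take-length-++ xs ys)

  drop-length-++ : ∀ (xs ys : List A) → drop (length xs) (xs ++ ys) ≡ ys
  drop-length-++ []       ys = refl
  drop-length-++ (x ∷ xs) ys = drop-length-++ xs ys

  length-take-≤ : ∀ k (xs : List A) → k ≤ length xs → length (take k xs) ≡ k
  length-take-≤ k xs k≤n = trans (length-take k xs) (m≤n⇒m⊓n≡m k≤n)

module _ {n : ℕ} where
  open ≡-Reasoning

  flipSign-involutive : ∀ (x : Fin n × Bool) → flipSign (flipSign x) ≡ x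
  flipSign-involutive (a , s) = cong (a ,_) (not-involutive s)

  length-flipped-prefix : ∀ k (w : Word n) → k ≤ length w → length (map flipSign (reverse (take k w))) ≡ k
  length-flipped-prefix k w k≤n = begin
    length (map flipSign (reverse (take k w))) ≡⟨ length-map flipSign (reverse (take k w)) ⟩
    length (reverse (take k w))                ≡⟨ length-reverse (take k w) ⟩
    length (take k w)                          ≡⟨ length-take-≤ k w k≤n ⟩
    k                                          ∎

  length-prefixRev : ∀ k (w : Word n) → k ≤ length w → length (prefixRev k w) ≡ length w
  length-prefixRev k w k≤n = begin
    length (prefixRev k w)                                        ≡⟨ length-++ (map flipSign (reverse (take k w))) ⟩
    length (map flipSign (reverse (take k w))) + length (drop k w) ≡⟨ cong₂ _+_ (length-flipped-prefix k w k≤n) (length-drop k w) ⟩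
    k + (length w ∸ k)                                            ≡⟨ m+[n∸m]≡n k≤n ⟩
    length w                                                      ∎

  prefixRev-++ : ∀ (xs ys : Word n) → prefixRev (length xs) (xs ++ ys) ≡ map flipSign (reverse xs) ++ ys
  prefixRev-++ xs ys = cong₂ (λ p d → map flipSign (reverse p) ++ d) (take-length-++ xs ys) (drop-length-++ xs ys)

  flipped-reverse-involutive : ∀ (xs : Word n) → map flipSign (reverse (map flipSign (reverse xs))) ≡ xs
  flipped-reverse-involutive xs = begin
    map flipSign (reverse (map flipSign (reverse xs))) ≡⟨ cong (map flipSign) (reverse-map flipSign (reverse xs)) ⟨
    map flipSign (map flipSign (reverse (reverse xs))) ≡⟨ map-∘ (reverse (reverse xs)) ⟨
    map (flipSign ∘ flipSign) (reverse (reverse xs))   ≡⟨ map-cong flipSign-involutive (reverse (reverse xs)) ⟩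
    map (λ x → x) (reverse (reverse xs))               ≡⟨ map-id (reverse (reverse xs)) ⟩
    reverse (reverse xs)                               ≡⟨ reverse-involutive xs ⟩
    xs                                                 ∎

  prefixRev-involutive : ∀ k (w : Word n) → k ≤ length w → prefixRev k (prefixRev k w) ≡ w
  prefixRev-involutive k w k≤n = begin
    prefixRev k (P ++ drop k w)                         ≡⟨ cong (λ j → prefixRev j (P ++ drop k w)) (length-flipped-prefix k w k≤n) ⟨
    prefixRev (length P) (P ++ drop k w)                ≡⟨ prefixRev-++ P (drop k w) ⟩
    map flipSign (reverse P) ++ drop k w                ≡⟨ cong (_++ drop k w) (flipped-reverse-involutive (take k w)) ⟩
    take k w ++ drop k w                                ≡⟨ take++drop≡id k w ⟩
    w                                                   ∎
    where P = map flipSign (reverse (take k w))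

  nth-prefixRev-≤ : ∀ {i q} (w : Word n) → i < length w → q ≤ i →
                    nth (prefixRev (suc i) w) (i ∸ q) ≡ Maybe.map flipSign (nth w q)
  nth-prefixRev-≤ {i} {q} w i<n q≤i = begin
    nth (map flipSign (reverse T) ++ drop (suc i) w) (i ∸ q) ≡⟨ nth-++ˡ (map flipSign (reverse T))
                                                                  (subst (i ∸ q <_) (sym (length-flipped-prefix (suc i) w i<n)) i∸q<1+i) ⟩
    nth (map flipSign (reverse T)) (i ∸ q)                   ≡⟨ nth-map flipSign (reverse T) (i ∸ q) ⟩
    Maybe.map flipSign (nth (reverse T) (i ∸ q))             ≡⟨ cong (Maybe.map flipSign) (nth-reverse T (subst (i ∸ q <_) (sym |T|≡1+i) i∸q<1+i)) ⟩
    Maybe.map flipSign (nth T (length T ∸ suc (i ∸ q)))      ≡⟨ cong (λ k → Maybe.map flipSign (nth T (k ∸ suc (i ∸ q)))) |T|≡1+i ⟩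
    Maybe.map flipSign (nth T (i ∸ (i ∸ q)))                 ≡⟨ cong (Maybe.map flipSign ∘ nth T) (m∸[m∸n]≡n q≤i) ⟩
    Maybe.map flipSign (nth T q)                             ≡⟨ cong (Maybe.map flipSign) (nth-take (suc i) w (s≤s q≤i)) ⟩
    Maybe.map flipSign (nth w q)                             ∎
    where
      T = take (suc i) w
      |T|≡1+i = length-take-≤ (suc i) w i<n
      i∸q<1+i = s≤s (m∸n≤m i q)

  nth-prefixRev-> : ∀ {i q} (w : Word n) → i < length w → i < q → nth (prefixRev (suc i) w) q ≡ nth w q
  nth-prefixRev-> {i} {q} w i<n i<q = begin
    nth (P ++ drop (suc i) w) q                    ≡⟨ cong (nth (P ++ drop (suc i) w)) q≡|P|+d ⟩
    nth (P ++ drop (suc i) w) (length P + d)       ≡⟨ nth-++ʳ P d ⟩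
    nth (drop (suc i) w) d                         ≡⟨ nth-drop (suc i) w d ⟩
    nth w (suc i + d)                              ≡⟨ cong (nth w) (m+[n∸m]≡n i<q) ⟩
    nth w q                                        ∎
    where
      P = map flipSign (reverse (take (suc i) w))
      d = q ∸ suc i
      q≡|P|+d : q ≡ length P + d
      q≡|P|+d = trans (sym (m+[n∸m]≡n i<q)) (cong (_+ d) (sym (length-flipped-prefix (suc i) w i<n)))

  labels-prefixRev : ∀ k (w : Word n) →
                     map proj₁ (prefixRev k w) ≡ reverse (take k (map proj₁ w)) ++ drop k (map proj₁ w)
  labels-prefixRev k w = begin
    map proj₁ (map flipSign (reverse T) ++ drop k w)              ≡⟨ map-++ proj₁ (map flipSign (reverse T)) (drop k w) ⟩
    map proj₁ (map flipSign (reverse T)) ++ map proj₁ (drop k w)  ≡⟨ cong₂ _++_ (map-∘ (reverse T)) (drop-map k w) ⟨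
    map proj₁ (reverse T) ++ drop k ls                            ≡⟨ cong (_++ drop k ls) (reverse-map proj₁ T) ⟩
    reverse (map proj₁ T) ++ drop k ls                            ≡⟨ cong (λ t → reverse t ++ drop k ls) (take-map k w) ⟨
    reverse (take k ls) ++ drop k ls                              ∎
    where
      T = take k w
      ls = map proj₁ w

  prefixRev-preserves-IsSignedPerm : ∀ k (w : Word n) → k ≤ n → IsSignedPerm n w → IsSignedPerm n (prefixRev k w)
  prefixRev-preserves-IsSignedPerm k w k≤n (|w|≡n , unique) =
    trans (length-prefixRev k w (subst (k ≤_) (sym |w|≡n) k≤n)) |w|≡n ,
    subst Unique (sym (labels-prefixRev k w))
      (PermutationSetoid.Unique-resp-↭ (setoid _) (↭⇒↭ₛ (↭-sym (++⁺ʳ (drop k ls) (↭-reverse (take k ls)))))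
        (subst Unique (sym (take++drop≡id k ls)) unique))
    where ls = map proj₁ w

  r-preserves-IsSignedPerm : ∀ i (w : Word n) → IsSignedPerm n w → IsSignedPerm n (r i w)
  r-preserves-IsSignedPerm i w = prefixRev-preserves-IsSignedPerm (suc (toℕ i)) w (toℕ<n i)

  r-involutive : ∀ i (w : Word n) → length w ≡ n → r i (r i w) ≡ w
  r-involutive i w |w|≡n = prefixRev-involutive (suc (toℕ i)) w (subst (suc (toℕ i) ≤_) (sym |w|≡n) (toℕ<n i))

  orient : Bool → Fin n × Bool → Fin n × Bool
  orient true  e = e
  orient false e = flipSign e

  flipSign-orient : ∀ s e → flipSign (orient s e) ≡ orient (not s) e
  flipSign-orient true  e = refl
  flipSign-orient false e = flipSign-involutive e

  label-orient : ∀ s e → proj₁ (orient s e) ≡ proj₁ e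
  label-orient true  e = refl
  label-orient false e = refl

  orient-fixed⇒upright : ∀ s (e : Fin n × Bool) → orient s e ≡ e → s ≡ true
  orient-fixed⇒upright true  e           _  = refl
  orient-fixed⇒upright false (a , true)  ()
  orient-fixed⇒upright false (a , false) ()

  Sits : Word n → ℕ × Bool → Fin n × Bool → Set
  Sits w (q , s) e = nth w q ≡ just (orient s e)

  r-moves-pancake : ∀ i (w : Word n) {p e} → length w ≡ n → Sits w p e → Sits (r i w) (flipAt (toℕ i) p) e
  r-moves-pancake i w {q , s} {e} |w|≡n sits with ≤-<-connex q (toℕ i)
  ... | inj₁ q≤i rewrite flipAt-≤ s q≤i = begin
    nth (r i w) (toℕ i ∸ q)            ≡⟨ nth-prefixRev-≤ w i<|w| q≤i ⟩
    Maybe.map flipSign (nth w q)       ≡⟨ cong (Maybe.map flipSign) sits ⟩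
    just (flipSign (orient s e))       ≡⟨ cong just (flipSign-orient s e) ⟩
    just (orient (not s) e)            ∎
    where i<|w| = subst (toℕ i <_) (sym |w|≡n) (toℕ<n i)
  ... | inj₂ i<q rewrite flipAt-> s i<q =
    trans (nth-prefixRev-> w (subst (toℕ i <_) (sym |w|≡n) (toℕ<n i)) i<q) sits

  Sits-upright-unique : ∀ {w q q′ s e} → IsSignedPerm n w → Sits w (q , true) e → Sits w (q′ , s) e → q′ ≡ q × s ≡ true
  Sits-upright-unique {w} {q} {q′} {s} {e} (_ , unique) sits sits′ = q′≡q , orient-fixed⇒upright s e (just-injective orient≡e)
    where
      q′≡q = nth-injective proj₁ w unique sits′ sits (label-orient s e)
      orient≡e : just (orient s e) ≡ just e
      orient≡e = trans (sym sits′) (trans (cong (nth w) q′≡q) sits)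

module _ {A : Set} where

  Unique⇒lookup-injective : ∀ {xs : List A} → Unique xs → ∀ {i j} → lookup xs i ≡ lookup xs j → i ≡ j
  Unique⇒lookup-injective {x ∷ xs} _          {zero}  {zero}  _  = refl
  Unique⇒lookup-injective {x ∷ xs} (x∉ ∷ _)   {zero}  {suc j} eq = ⊥-elim (All.lookup x∉ (∈-lookup j) eq)
  Unique⇒lookup-injective {x ∷ xs} (x∉ ∷ _)   {suc i} {zero}  eq = ⊥-elim (All.lookup x∉ (∈-lookup i) (sym eq))
  Unique⇒lookup-injective {x ∷ xs} (_ ∷ uniq) {suc i} {suc j} eq = cong suc (Unique⇒lookup-injective uniq eq)

  Unique-⊆⇒length≤ : ∀ {xs ys : List A} → Unique xs → xs ⊆ ys → length xs ≤ length ys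
  Unique-⊆⇒length≤ uniq xs⊆ys = injective⇒≤ λ {i} {j} eq →
    Unique⇒lookup-injective uniq (index-injective (setoid A) (xs⊆ys (∈-lookup i)) (xs⊆ys (∈-lookup j)) eq)

module _ {A B : Set} (f : A → List B) where

  length-concatMap-≤ : ∀ xs {b} → (∀ {x} → x ∈ xs → length (f x) ≤ b) → length (concatMap f xs) ≤ length xs * b
  length-concatMap-≤ []       _     = z≤n
  length-concatMap-≤ (x ∷ xs) {b} f≤b = begin
    length (f x ++ concatMap f xs)          ≡⟨ length-++ (f x) ⟩
    length (f x) + length (concatMap f xs)  ≤⟨ +-mono-≤ (f≤b (here refl)) (length-concatMap-≤ xs (λ x∈ → f≤b (there x∈))) ⟩
    b + length xs * b                       ∎
    where open ≤-Reasoning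

  length-concatMap-const : ∀ xs {b} → (∀ x → length (f x) ≡ b) → length (concatMap f xs) ≡ length xs * b
  length-concatMap-const []       _     = refl
  length-concatMap-const (x ∷ xs) |f|≡b = trans (length-++ (f x)) (cong₂ _+_ (|f|≡b x) (length-concatMap-const xs |f|≡b))

module _ {n : ℕ} where

  without : Fin n → List (Fin n) → List (Fin n)
  without x = filter (λ y → ¬? (x Fin.≟ y))

  without-shrinks : ∀ {x} S → x ∈ S → length (without x S) < length S
  without-shrinks {x} S x∈S = filter-notAll (λ y → ¬? (x Fin.≟ y)) S (Any.map (λ x≡y x≢y → x≢y x≡y) x∈S)

  ∈-without : ∀ {x y S} → y ∈ S → x ≢ y → y ∈ without x S
  ∈-without {x} y∈S x≢y = ∈-filter⁺ (λ y → ¬? (x Fin.≟ y)) y∈S x≢y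

  signs : List Bool
  signs = true ∷ false ∷ []

  ∈-signs : ∀ s → s ∈ signs
  ∈-signs true  = here refl
  ∈-signs false = there (here refl)

  signedArrangements : ℕ → List (Fin n) → List (Word n)
  headedBy : ℕ → List (Fin n) → Fin n × Bool → List (Word n)

  signedArrangements zero    S = [ [] ]
  signedArrangements (suc k) S = concatMap (λ x → concatMap (λ s → headedBy k S (x , s)) signs) S

  headedBy k S (x , s) = map ((x , s) ∷_) (signedArrangements k (without x S))

  ∈-signedArrangements : ∀ k S (w : Word n) → length w ≡ k → Unique (map proj₁ w) → All (_∈ S) (map proj₁ w) →
                         w ∈ signedArrangements k S
  ∈-signedArrangements zero    S []            _      _          _ = here refl
  ∈-signedArrangements (suc k) S ((x , s) ∷ w) |w|≡k (x∉ ∷ uniq) (x∈S ∷ w⊆S) =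
    ∈-concatMap⁺ (λ x → concatMap (λ s → headedBy k S (x , s)) signs) (Any.map (λ { refl →
      ∈-concatMap⁺ (λ s → headedBy k S (x , s)) (Any.map (λ { refl → ∈-map⁺ ((x , s) ∷_) w∈ }) (∈-signs s)) }) x∈S)
    where
      w∈ = ∈-signedArrangements k (without x S) w (suc-injective |w|≡k) uniq
             (All.zipWith (λ (y∈S , x≢y) → ∈-without y∈S x≢y) (w⊆S , x∉))

  length-signedArrangements : ∀ k S → length S ≤ k → length (signedArrangements k S) ≤ 2 ^ k * k !
  length-signedArrangements zero    S _    = ≤-refl
  length-signedArrangements (suc k) S |S|≤1+k = begin
    length (signedArrangements (suc k) S) ≤⟨ length-concatMap-≤ (λ x → concatMap (λ s → headedBy k S (x , s)) signs) S per-label ⟩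
    length S * (2 * (2 ^ k * k !))         ≤⟨ *-monoˡ-≤ _ |S|≤1+k ⟩
    suc k * (2 * (2 ^ k * k !))            ≡⟨ solve 3 (λ k a b → (con 1 :+ k) :* (con 2 :* (a :* b)) := con 2 :* a :* ((con 1 :+ k) :* b))
                                                      refl k (2 ^ k) (k !) ⟩
    2 ^ suc k * suc k !                    ∎
    where
      open ≤-Reasoning
      open +-*-Solver
      per-label : ∀ {x} → x ∈ S → length (concatMap (λ s → headedBy k S (x , s)) signs) ≤ 2 * (2 ^ k * k !)
      per-label {x} x∈S = length-concatMap-≤ (λ s → headedBy k S (x , s)) signs λ {s} _ → begin
        length (headedBy k S (x , s))                 ≡⟨ length-map ((x , s) ∷_) (signedArrangements k (without x S)) ⟩
        length (signedArrangements k (without x S))   ≤⟨ length-signedArrangements k (without x S)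
                                                           (≤-pred (≤-trans (without-shrinks S x∈S) |S|≤1+k)) ⟩
        2 ^ k * k !                                   ∎

signedPermutations : ∀ n → List (Word n)
signedPermutations n = signedArrangements n (allFin n)

∈-signedPermutations : ∀ {n w} → IsSignedPerm n w → w ∈ signedPermutations n
∈-signedPermutations {n} {w} (|w|≡n , uniq) =
  ∈-signedArrangements n (allFin n) w |w|≡n uniq (All.tabulate (λ {x} _ → ∈-allFin x))

allDarts : ∀ n → List (Dart n)
allDarts n = concatMap (λ π → map (π ,_) (allFin n)) (signedPermutations n)

∈-allDarts : ∀ {n d} → IsDart n d → d ∈ allDarts n
∈-allDarts {n} {π , i} isπ =
  ∈-concatMap⁺ (λ π → map (π ,_) (allFin n)) (Any.map (λ { refl → ∈-map⁺ (π ,_) (∈-allFin i) }) (∈-signedPermutations isπ))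

length-allDarts : ∀ n → length (allDarts n) ≤ 2 ^ n * n ! * n
length-allDarts n = begin
  length (allDarts n)                ≤⟨ length-concatMap-≤ (λ π → map (π ,_) (allFin n)) (signedPermutations n)
                                                           (λ {π} _ → ≤-reflexive |allFin|) ⟩
  length (signedPermutations n) * n  ≤⟨ *-monoˡ-≤ n (length-signedArrangements n (allFin n) (≤-reflexive (length-tabulate (λ i → i)))) ⟩
  2 ^ n * n ! * n                    ∎
  where
    open ≤-Reasoning
    |allFin| : ∀ {π} → length (map (π ,_) (allFin n)) ≡ n
    |allFin| {π} = trans (length-map (π ,_) (allFin n)) (length-tabulate (λ i → i))

module _ {A : Set} (f : A → A) where

  iter-+ : ∀ a b x → iter (a + b) f x ≡ iter a f (iter b f x)
  iter-+ zero    b x = refl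
  iter-+ (suc a) b x = cong f (iter-+ a b x)

  iter-fixed : ∀ {x} → f x ≡ x → ∀ t → iter t f x ≡ x
  iter-fixed fx≡x zero    = refl
  iter-fixed fx≡x (suc t) = trans (cong f (iter-fixed fx≡x t)) fx≡x

  iter-multiple : ∀ {x p} → iter p f x ≡ x → ∀ k → iter (k * p) f x ≡ x
  iter-multiple         returns zero    = refl
  iter-multiple {x} {p} returns (suc k) =
    trans (iter-+ p (k * p) x) (trans (cong (iter p f) (iter-multiple returns k)) returns)

  iter-meet⇒reach : ∀ {x y a b p} → iter (suc p) f y ≡ y → iter a f x ≡ iter b f y → iter (b * p + a) f x ≡ y
  iter-meet⇒reach {x} {y} {a} {b} {p} returns meet = begin
    iter (b * p + a) f x         ≡⟨ iter-+ (b * p) a x ⟩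
    iter (b * p) f (iter a f x)  ≡⟨ cong (iter (b * p) f) meet ⟩
    iter (b * p) f (iter b f y)  ≡⟨ iter-+ (b * p) b y ⟨
    iter (b * p + b) f y         ≡⟨ cong (λ k → iter k f y) (trans (+-comm (b * p) b) (sym (*-suc b p))) ⟩
    iter (b * suc p) f y         ≡⟨ iter-multiple returns b ⟩
    y                            ∎
    where open ≡-Reasoning

module _ (g : ℕ → ℕ) {c : ℕ} (periodic : ∀ j → g (c + j) ≡ g j) where

  periodic-multiple : ∀ k j → g (k * c + j) ≡ g j
  periodic-multiple zero    j = refl
  periodic-multiple (suc k) j = begin
    g (c + k * c + j)   ≡⟨ cong g (+-assoc c (k * c) j) ⟩
    g (c + (k * c + j)) ≡⟨ periodic (k * c + j) ⟩
    g (k * c + j)       ≡⟨ periodic-multiple k j ⟩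
    g j                 ∎
    where open ≡-Reasoning

periodic-attains-max : ∀ (g : ℕ → ℕ) c → 1 ≤ c → (∀ j → g (c + j) ≡ g j) → ∃ λ s → ∀ j → g j ≤ g s
periodic-attains-max g (suc c) _ periodic = s , g≤gs
  where
    s = argmax g 0 (upTo (suc c))
    g≤gs : ∀ j → g j ≤ g s
    g≤gs j = begin
      g j                               ≡⟨ cong g (trans (m≡m%n+[m/n]*n j (suc c)) (+-comm (j % suc c) _)) ⟩
      g (j / suc c * suc c + j % suc c) ≡⟨ periodic-multiple g periodic (j / suc c) (j % suc c) ⟩
      g (j % suc c)                     ≤⟨ All.lookup (f[xs]≤f[argmax] {f = g} 0 (upTo (suc c))) (∈-upTo⁺ (m%n<n j (suc c))) ⟩
      g s                               ∎
      where open ≤-Reasoning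

cyclicPerm-fixedPointFree : ∀ {n f} → 1 < n → IsCyclicPerm n f → ∀ i → f i ≢ i
cyclicPerm-fixedPointFree {suc zero} (s≤s ()) _
cyclicPerm-fixedPointFree {suc (suc k)} {f} _ (_ , reaches) zero fi≡i
  with t , reached ← reaches zero (suc zero)
  with () ← trans (sym (iter-fixed f fi≡i t)) reached
cyclicPerm-fixedPointFree {suc (suc k)} {f} _ (_ , reaches) (suc i) fi≡i
  with t , reached ← reaches (suc i) zero
  with () ← trans (sym (iter-fixed f fi≡i t)) reached

module _ {A : Set} (f : A → A) {P : A → Set} (f-preserves : ∀ {x} → P x → P (f x)) where

  iter-preserves : ∀ t {x} → P x → P (iter t f x)
  iter-preserves zero    Px = Px
  iter-preserves (suc t) Px = f-preserves (iter-preserves t Px)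

  module _ (f-injective : ∀ {x y} → P x → P y → f x ≡ f y → x ≡ y) where

    iter-injective : ∀ t {x y} → P x → P y → iter t f x ≡ iter t f y → x ≡ y
    iter-injective zero    Px Py eq = eq
    iter-injective (suc t) Px Py eq = iter-injective t Px Py (f-injective (iter-preserves t Px) (iter-preserves t Py) eq)

    iter-returns : ∀ (xs : List A) → (∀ {x} → P x → x ∈ xs) → ∀ {x} → P x → ∃ λ p → 1 ≤ p × iter p f x ≡ x
    iter-returns xs P⊆xs {x} Px
      with i , j , i<j , same-index ← pigeonhole (n<1+n (length xs)) (λ t → index (P⊆xs (iter-preserves (toℕ t) Px)))
      = toℕ j ∸ toℕ i , m<n⇒0<n∸m i<j , sym (iter-injective (toℕ i) Px (iter-preserves (toℕ j ∸ toℕ i) Px) (begin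
          iter (toℕ i) f x                           ≡⟨ index-injective (setoid A) (P⊆xs (iter-preserves (toℕ i) Px))
                                                                                 (P⊆xs (iter-preserves (toℕ j) Px)) same-index ⟩
          iter (toℕ j) f x                           ≡⟨ cong (λ k → iter k f x) (m+[n∸m]≡n (<⇒≤ i<j)) ⟨
          iter (toℕ i + (toℕ j ∸ toℕ i)) f x         ≡⟨ iter-+ f (toℕ i) (toℕ j ∸ toℕ i) x ⟩
          iter (toℕ i) f (iter (toℕ j ∸ toℕ i) f x)  ∎))
      where open ≡-Reasoning

module Faces {n : ℕ} (ρ : RotationSystem n) (isRotation : IsRotationSystem n ρ) (1<n : 1 < n) where

  φ : Dart n → Dart n
  φ = facePerm ρ

  φ-preserves-IsDart : ∀ {d} → IsDart n d → IsDart n (φ d)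
  φ-preserves-IsDart {π , i} = r-preserves-IsSignedPerm i π

  iterφ-preserves-IsDart : ∀ t {d} → IsDart n d → IsDart n (iter t φ d)
  iterφ-preserves-IsDart = iter-preserves φ φ-preserves-IsDart

  φ-injective : ∀ {d d′} → IsDart n d → IsDart n d′ → φ d ≡ φ d′ → d ≡ d′
  φ-injective {π , i} {π′ , i′} isπ isπ′ φd≡φd′
    with refl ← proj₁ (isRotation (r i π) (r-preserves-IsSignedPerm i π isπ))
                  (trans (cong proj₂ φd≡φd′) (cong (λ σ → ρ σ i′) (sym (cong proj₁ φd≡φd′))))
    = cong (_, i) (begin
        π           ≡⟨ r-involutive i π (proj₁ isπ) ⟨
        r i (r i π)  ≡⟨ cong (r i) (cong proj₁ φd≡φd′) ⟩
        r i (r i π′) ≡⟨ r-involutive i π′ (proj₁ isπ′) ⟩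
        π′           ∎)
    where open ≡-Reasoning

  module FaceWalk (d : Dart n) (isDart : IsDart n d) where

    walk : ℕ → Dart n
    walk t = iter t φ d

    word : ℕ → Word n
    word t = proj₁ (walk t)

    label : ℕ → Fin n
    label t = proj₂ (walk t)

    ℓ : ℕ → ℕ
    ℓ t = toℕ (label t)

    word-IsSignedPerm : ∀ t → IsSignedPerm n (word t)
    word-IsSignedPerm t = iterφ-preserves-IsDart t isDart

    ℓ-stutter-free : ∀ j → ℓ (suc j) ≢ ℓ j
    ℓ-stutter-free j eq = cyclicPerm-fixedPointFree 1<n (isRotation (word (suc j)) (word-IsSignedPerm (suc j)))
                            (label j) (toℕ-injective eq)

    pancake-tracks : ∀ t j {p e} → Sits (word j) p e → Sits (word (t + j)) (flips (window ℓ j t) p) e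
    pancake-tracks zero    j sits = sits
    pancake-tracks (suc t) j {p} {e} sits =
      subst (λ k → Sits (word k) (flips (window ℓ j (suc t)) p) e) (+-suc t j)
        (pancake-tracks t (suc j) (r-moves-pancake (label j) (word j) (proj₁ (word-IsSignedPerm j)) sits))

    module Closed (c : ℕ) (closed : iter c φ d ≡ d) where

      walk-periodic : ∀ j → walk (c + j) ≡ walk j
      walk-periodic j = begin
        iter (c + j) φ d       ≡⟨ cong (λ k → iter k φ d) (+-comm c j) ⟩
        iter (j + c) φ d       ≡⟨ iter-+ φ j c d ⟩
        iter j φ (iter c φ d)  ≡⟨ cong (iter j φ) closed ⟩
        iter j φ d             ∎
        where open ≡-Reasoning

      ℓ-periodic : ∀ j → ℓ (c + j) ≡ ℓ j
      ℓ-periodic j = cong (λ δ → toℕ (proj₂ δ)) (walk-periodic j)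

      every-window-returns : ∀ j {q} → q < n → flips (window ℓ j c) (q , true) ≡ (q , true)
      every-window-returns j {q} q<n
        with e , at-q ← nth-defined (word j) (subst (q <_) (sym (proj₁ (word-IsSignedPerm j))) q<n)
        with q′≡q , s≡true ← Sits-upright-unique (word-IsSignedPerm j) at-q
                               (subst (λ δ → Sits (proj₁ δ) (flips (window ℓ j c) (q , true)) e) (walk-periodic j)
                                      (pancake-tracks c j at-q))
        = cong₂ _,_ q′≡q s≡true

      no-short-period : 1 ≤ c → c ≤ 7 → ⊥
      no-short-period 1≤c c≤7
        with s , ℓ≤ℓs ← periodic-attains-max ℓ c 1≤c ℓ-periodic
        with j , sinks ← ShortPeriod.short-period-sinks ℓ (ℓ s) s ℓ≤ℓs refl ℓ-stutter-free c 1≤c c≤7 ℓ-periodic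
        = sinks (every-window-returns j (toℕ<n (label s)))

  no-short-face : ∀ {d} → IsDart n d → ∀ c → 1 ≤ c → c ≤ 7 → iter c φ d ≢ d
  no-short-face {d} isDart c 1≤c c≤7 closed = FaceWalk.Closed.no-short-period d isDart c closed 1≤c c≤7

  φ-returns : ∀ {d} → IsDart n d → ∃ λ p → 1 ≤ p × iter p φ d ≡ d
  φ-returns = iter-returns φ φ-preserves-IsDart φ-injective (allDarts n) ∈-allDarts

  -- opaque: with the literal 8 exposed, unification unfolds up to eight applications of φ.
  opaque
    faceBlock : Dart n → List (Dart n)
    faceBlock e = applyUpTo (λ a → iter a φ e) 8

    length-faceBlock : ∀ e → length (faceBlock e) ≡ 8
    length-faceBlock e = length-applyUpTo (λ a → iter a φ e) 8

    ∈-faceBlock⁻ : ∀ {v e} → v ∈ faceBlock e → ∃ λ a → a < 8 × v ≡ iter a φ e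
    ∈-faceBlock⁻ {e = e} = ∈-applyUpTo⁻ (λ a → iter a φ e)

    faceBlock-IsDart : ∀ {e} → IsDart n e → All (IsDart n) (faceBlock e)
    faceBlock-IsDart {e} isE = All.applyUpTo⁺₁ (λ a → iter a φ e) 8 (λ {a} _ → iterφ-preserves-IsDart a isE)

    faceBlock-Unique : ∀ {e} → IsDart n e → Unique (faceBlock e)
    faceBlock-Unique {e} isE = applyUpTo⁺₁ (λ a → iter a φ e) 8 λ {a} {b} a<b b<8 eq →
      no-short-face (iterφ-preserves-IsDart a isE) (b ∸ a) (m<n⇒0<n∸m a<b) (≤-trans (m∸n≤m b a) (≤-pred b<8)) (begin
        iter (b ∸ a) φ (iter a φ e) ≡⟨ iter-+ φ (b ∸ a) a e ⟨
        iter (b ∸ a + a) φ e        ≡⟨ cong (λ k → iter k φ e) (m∸n+n≡m (<⇒≤ a<b)) ⟩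
        iter b φ e                  ≡⟨ eq ⟨
        iter a φ e                  ∎)
      where open ≡-Reasoning

  faceBlocks-Disjoint : ∀ {e e′} → IsDart n e′ → ¬ SameFace ρ e e′ → Disjoint (faceBlock e) (faceBlock e′)
  faceBlocks-Disjoint {e} {e′} isE′ ¬same {v} (v∈ , v∈′) =
    ¬same (reach (∈-faceBlock⁻ v∈) (∈-faceBlock⁻ v∈′) (φ-returns isE′))
    where
      reach : (∃ λ a → a < 8 × v ≡ iter a φ e) → (∃ λ b → b < 8 × v ≡ iter b φ e′) →
              (∃ λ p → 1 ≤ p × iter p φ e′ ≡ e′) → SameFace ρ e e′
      reach (a , _ , v≡) (b , _ , v≡′) (suc p , _ , returns) =
        b * p + a , iter-meet⇒reach φ {e} {e′} {a} {b} {p} returns (trans (sym v≡) v≡′)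

  faceBlocks-pairwise-Disjoint : ∀ reps → All (IsDart n) reps → AllPairs (λ d e → ¬ SameFace ρ d e) reps →
                                 AllPairs Disjoint (map faceBlock reps)
  faceBlocks-pairwise-Disjoint []       []             []                  = []
  faceBlocks-pairwise-Disjoint (e ∷ es) (_ ∷ areDarts) (¬sames ∷ distinct) =
    All.map⁺ (All.zipWith (λ (isE′ , ¬same) {v} → faceBlocks-Disjoint isE′ ¬same {v}) (areDarts , ¬sames))
    ∷ faceBlocks-pairwise-Disjoint es areDarts distinct

  faceBlocks-IsDart : ∀ reps → All (IsDart n) reps → All (IsDart n) (concatMap faceBlock reps)
  faceBlocks-IsDart reps areDarts = All.concat⁺ (All.map⁺ (All.map faceBlock-IsDart areDarts))

  faceCount-bound : ∀ {F} → HasFaceCount n ρ F → 8 * F ≤ length (allDarts n)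
  faceCount-bound {F} (reps , |reps|≡F , areDarts , distinct , _) = begin
    8 * F                             ≡⟨ cong (8 *_) |reps|≡F ⟨
    8 * length reps                   ≡⟨ *-comm 8 (length reps) ⟩
    length reps * 8                   ≡⟨ length-concatMap-const faceBlock reps length-faceBlock ⟨
    length (concatMap faceBlock reps) ≤⟨ Unique-⊆⇒length≤ unique (λ v∈ → ∈-allDarts (All.lookup (faceBlocks-IsDart reps areDarts) v∈)) ⟩
    length (allDarts n)               ∎
    where
      open ≤-Reasoning
      unique : Unique (concatMap faceBlock reps)
      unique = Unique.concat⁺ (All.map⁺ (All.map faceBlock-Unique areDarts)) (faceBlocks-pairwise-Disjoint reps areDarts distinct)

girth-Euler-bound : ∀ k V E F g → V + F + 2 * g ≡ 2 + E → k * F ≤ 2 * E → 2 * k + k * E ≤ k * (V + 2 * g) + 2 * E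
girth-Euler-bound k V E F g euler kF≤2E = begin
  2 * k + k * E                ≡⟨ solve 2 (λ k E → con 2 :* k :+ k :* E := k :* (con 2 :+ E)) refl k E ⟩
  k * (2 + E)                  ≡⟨ cong (k *_) euler ⟨
  k * (V + F + 2 * g)          ≡⟨ solve 4 (λ k V F g → k :* (V :+ F :+ con 2 :* g) := k :* (V :+ con 2 :* g) :+ k :* F) refl k V F g ⟩
  k * (V + 2 * g) + k * F      ≤⟨ +-monoʳ-≤ (k * (V + 2 * g)) kF≤2E ⟩
  k * (V + 2 * g) + 2 * E      ∎
  where
    open ≤-Reasoning
    open +-*-Solver

3[3+t]∸8 : ∀ t → 3 * (3 + t) ∸ 8 ≡ 1 + 3 * t
3[3+t]∸8 t = trans (cong (_∸ 8) (solve 1 (λ t → con 3 :* (con 3 :+ t) := con 8 :+ (con 1 :+ con 3 :* t)) refl t))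
                   (m+n∸m≡n 8 (1 + 3 * t))
  where open +-*-Solver

burntPancake-genus-arithmetic : ∀ t g →
  2 * 8 + 8 * numEdges (3 + t) ≤ 8 * (numVertices (3 + t) + 2 * g) + 2 * numEdges (3 + t) →
  2 ^ t * (3 * (3 + t) ∸ 8) * (3 + t) ! + 2 ≤ 2 * g
burntPancake-genus-arithmetic t g bound = *-cancelˡ-≤ 8 (+-cancelʳ-≤ (8 * V + 2 * E) _ _ (begin
  8 * (a * (3 * (3 + t) ∸ 8) * b + 2) + (8 * V + 2 * E) ≡⟨ cong (λ x → 8 * (a * x * b + 2) + (8 * V + 2 * E)) (3[3+t]∸8 t) ⟩
  8 * (a * (1 + 3 * t) * b + 2) + (8 * V + 2 * E)       ≡⟨ solve 3 (λ t a b →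
      con 8 :* (a :* (con 1 :+ con 3 :* t) :* b :+ con 2)
        :+ (con 8 :* (con 2 :* (con 2 :* (con 2 :* a)) :* b) :+ con 2 :* (con 2 :* (con 2 :* a) :* b :* (con 3 :+ t)))
      := con 2 :* con 8 :+ con 8 :* (con 2 :* (con 2 :* a) :* b :* (con 3 :+ t))) refl t a b ⟩
  2 * 8 + 8 * E                                         ≤⟨ bound ⟩
  8 * (V + 2 * g) + 2 * E                               ≡⟨ solve 3 (λ V E g → con 8 :* (V :+ con 2 :* g) :+ con 2 :* E
                                                              := con 8 :* (con 2 :* g) :+ (con 8 :* V :+ con 2 :* E)) refl V E g ⟩
  8 * (2 * g) + (8 * V + 2 * E)                         ∎))
  where
    open ≤-Reasoning
    open +-*-Solver
    a = 2 ^ t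
    b = (3 + t) !
    V = numVertices (3 + t)
    E = numEdges (3 + t)

twice-numEdges : ∀ m → 2 ^ suc m * suc m ! * suc m ≡ 2 * numEdges (suc m)
twice-numEdges m = solve 3 (λ a b c → con 2 :* a :* b :* c := con 2 :* (a :* b :* c)) refl (2 ^ m) (suc m !) (suc m)
  where open +-*-Solver

corollary4p6 : (n : ℕ) → 2 < n →
    TwiceGenusAtLeast n (2 ^ (n ∸ 3) * (3 * n ∸ 8) * n ! + 2)
corollary4p6 (suc (suc (suc t))) _ ρ isRotation g (F , faceCount , euler) =
  burntPancake-genus-arithmetic t g (girth-Euler-bound 8 (numVertices n) (numEdges n) F g euler (begin
    8 * F                ≤⟨ Faces.faceCount-bound ρ isRotation (s≤s (s≤s z≤n)) faceCount ⟩
    length (allDarts n)  ≤⟨ length-allDarts n ⟩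
    2 ^ n * n ! * n      ≡⟨ twice-numEdges (2 + t) ⟩
    2 * numEdges n       ∎))
  where
    open ≤-Reasoning
    n = 3 + t
corollary4p6 (suc zero)       (s≤s ())
corollary4p6 (suc (suc zero)) (s≤s (s≤s ()))
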